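{- Let $\alpha,\beta,\varepsilon>0$ and $k,m,n\in\mathbb N$ with $\beta m/6\ge 2\varepsilon n$ and $4\le k\le\frac32\beta m$. Let $P$ be an oriented path on $k$ vertices. Let $D$ be an $n$-vertex $\varepsilon n$-bipseudorandom digraph with $\delta(D)\ge 2\alpha n$ such that $D$ has an $(\alpha,\beta,m)$-reservoir $X$. Then for every pair of distinct $v,v'\in V(D)\setminus X$ such that $(v,v')$ is $(\alpha/2)$-compatible with $P$, and every $U\subseteq X$ with $|U|+k\le\frac32\beta m$, there exists a copy of $P$ in $D[(X\setminus U)\cup\{v,v'\}]$ with startpoint $v$ and endpoint $v'$.
   Context: $\delta(D)$ is the minimum total degree (indegree plus outdegree). $d^\pm$, $N^\pm$ denote out/in-degrees and neighbourhoods in $D$. For $1\le t\le n/2$, an $n$-vertex digraph is $t$-bipseudorandom if for every pair of disjoint vertex sets $U,W$ with $|U|=|W|=t$ there exist $u\in U$, $w\in W$ with both $uw$ and $wu$ edges (here $\varepsilon n$ is treated as an integer). A set $X\subseteq V(D)$ is an $(\alpha,\beta,m)$-reservoir if: $|X|=(1+\beta)m$ with $m,\beta m$ integers; for all $v\in V(D)$ and $*\in\{+,-\}$, $d^*(v)\ge\alpha n/2$ implies $|N^*(v)\cap X|\ge 2\beta m$; and there is a partition $X=X^+\cup X^-$ with $|X^+|,|X^-|\ge 2\beta m$ and $d^*(v)\ge\alpha n/2$ for all $v\in X^*$, $*\in\{+,-\}$. An oriented path $P=(u_1,\dots,u_k)$ is an undirected path each of whose edges is given exactly one direction; $\sigma(u_iu_{i+1})=+$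 if $u_iu_{i+1}\in E(P)$ and $-$ otherwise. $(v_1,v_k)$ is $\gamma$-compatible with $P$ if $d^*(v_1)\ge\gamma n$ for $*=\sigma(u_1u_2)$ and $d^*(v_k)\ge\gamma n$ for $*=\sigma(u_ku_{k-1})$. A copy of $P$ with startpoint $a$ and endpoint $b$ is a sequence of distinct vertices $(v_1,\dots,v_k)$, $v_1=a$, $v_k=b$, with $v_iv_{i+1}\in E(D)$ (resp. $v_{i+1}v_i\in E(D)$) whenever $u_iu_{i+1}\in E(P)$ (resp. $u_{i+1}u_i\in E(P)$).
   Formalization: The parameters α, β and ε range over the positive rationals. -}

module Defs where

open import Data.Bool using (Bool; true; false; not)
open import Data.Nat as ℕ using (ℕ; zero; suc; pred)
open import Data.Integer using (+_)
open import Data.Rational using (ℚ; _/_; _*_; _≤_)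
open import Data.Fin using (Fin; zero; suc; inject₁; fromℕ)
open import Data.Fin.Subset using (Subset; _∈_; _∉_; _∩_; _∪_; ∣_∣)
open import Data.Vec using (Vec; tabulate; lookup)
open import Data.Product using (Σ; _×_; ∃)
open import Data.Empty using (⊥)
open import Data.Unit using (⊤)
open import Relation.Binary.PropositionalEquality using (_≡_)
open import Function.Definitions using (Injective)

ℕ→ℚ : ℕ → ℚ
ℕ→ℚ k = + k / 1

-- A digraph on vertex set Fin n: loopless, no multiple edges
-- (adj u v = true means the edge uv is present; both uv and vu may be present).
record Digraph (n : ℕ) : Set where
  field
    adj      : Fin n → Fin n → Bool
    loopless : ∀ v → adj v v ≡ false
open Digraph public

module _ {n : ℕ} (D : Digraph n) where

  Nbr : Bool → Fin n → Subset n
  Nbr true  v = tabulate (λ w → adj D v w)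
  Nbr false v = tabulate (λ w → adj D w v)

  deg : Bool → Fin n → ℕ
  deg s v = ∣ Nbr s v ∣

  MinTotalDegreeAtLeast : ℚ → Set
  MinTotalDegreeAtLeast c = ∀ v → c ≤ ℕ→ℚ (deg true v ℕ.+ deg false v)

  Disjoint : Subset n → Subset n → Set
  Disjoint U W = ∀ x → x ∈ U → x ∉ W

  BiPseudorandom : ℕ → Set
  BiPseudorandom t =
    1 ℕ.≤ t × 2 ℕ.* t ℕ.≤ n ×
    (∀ (U W : Subset n) → Disjoint U W → ∣ U ∣ ≡ t → ∣ W ∣ ≡ t →
      Σ (Fin n) λ u → Σ (Fin n) λ w →
        u ∈ U × w ∈ W × adj D u w ≡ true × adj D w u ≡ true)

  EpsBiPseudorandom : ℚ → Set
  EpsBiPseudorandom ε = Σ ℕ λ t → ε * ℕ→ℚ n ≡ ℕ→ℚ t × BiPseudorandom t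

  -- X is an (α,β,m)-reservoir  (b = βm, an integer; |X| = (1+β)m = m + b)
  Reservoir : ℚ → ℚ → ℕ → Subset n → Set
  Reservoir α β m X = Σ ℕ λ b →
    β * ℕ→ℚ m ≡ ℕ→ℚ b ×
    ∣ X ∣ ≡ m ℕ.+ b ×
    (∀ v s → α * ℕ→ℚ n * (+ 1 / 2) ≤ ℕ→ℚ (deg s v) →
       2 ℕ.* b ℕ.≤ ∣ Nbr s v ∩ X ∣) ×
    Σ (Subset n) λ X⁺ → Σ (Subset n) λ X⁻ →
      Disjoint X⁺ X⁻ × X⁺ ∪ X⁻ ≡ X ×
      2 ℕ.* b ℕ.≤ ∣ X⁺ ∣ × 2 ℕ.* b ℕ.≤ ∣ X⁻ ∣ ×
      (∀ v → v ∈ X⁺ → α * ℕ→ℚ n * (+ 1 / 2) ≤ ℕ→ℚ (deg true v)) ×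
      (∀ v → v ∈ X⁻ → α * ℕ→ℚ n * (+ 1 / 2) ≤ ℕ→ℚ (deg false v))

-- An oriented path on k vertices u_1,…,u_k: entry i (0-based) of the vector
-- is σ(u_{i+1} u_{i+2}): true = '+' (edge u_{i+1}→u_{i+2}), false = '-'.
OPath : ℕ → Set
OPath k = Vec Bool (pred k)

module _ {n : ℕ} (D : Digraph n) where

  EdgeOK : Bool → Fin n → Fin n → Set
  EdgeOK true  a b = adj D a b ≡ true
  EdgeOK false a b = adj D b a ≡ true

  Follows : (k : ℕ) → OPath k → (Fin k → Fin n) → Set
  Follows zero    P f = ⊤
  Follows (suc j) P f = ∀ (i : Fin j) → EdgeOK (lookup P i) (f (inject₁ i)) (f (suc i))

  CopyIn : (k : ℕ) → OPath k → Fin n → Fin n → Subset n → Set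
  CopyIn zero    P a b S = ⊥
  CopyIn (suc j) P a b S = Σ (Fin (suc j) → Fin n) λ f →
    Injective _≡_ _≡_ f × Follows (suc j) P f ×
    f zero ≡ a × f (fromℕ j) ≡ b × (∀ i → f i ∈ S)

  -- (v₁,v_k) is γ-compatible with P
  -- (σ(u_k u_{k-1}) is the opposite of σ(u_{k-1} u_k))
  Compatible : ℚ → (k : ℕ) → OPath k → Fin n → Fin n → Set
  Compatible γ zero          P v v' = ⊥
  Compatible γ (suc zero)    P v v' = ⊥
  Compatible γ (suc (suc j)) P v v' =
    γ * ℕ→ℚ n ≤ ℕ→ℚ (deg D (lookup P zero) v) ×
    γ * ℕ→ℚ n ≤ ℕ→ℚ (deg D (not (lookup P (fromℕ j))) v')

module Submission where

-- Write t = εn and b = βm, so that 12t ≤ b and 2(|U| + k) ≤ 3b.  A double edge (present in both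
-- directions) can be traversed with either orientation, so it suffices to find in X ∖ U a path of
-- double edges on k − 2 vertices whose ends are suitable neighbours of v and of v′.  The reservoir
-- gives each of v, v′ at least 2b such neighbours in X; choose disjoint t-sets A and B of them
-- outside U.  By bipseudorandomness fewer than t vertices of the rest of X ∖ U have no double
-- neighbour in A, and fewer than t have none in B, so at least 2t + k − 5 vertices have both.
-- Depth-first search finds among them a double-edge path on k − 4 vertices, because every two
-- disjoint t-sets span a double edge; it extends through A and B to the required path.

open import Defs
open import Data.Bool as Bool using (Bool; true; false; not)
open import Data.Empty using (⊥-elim)
open import Data.Fin using (Fin; zero; suc; fromℕ)
open import Data.Fin.Properties using (any?)
open import Data.Fin.Subset
  using (Subset; ⊥; _∈_; _∉_; _⊆_; _∪_; _∩_; _─_; _-_; ⁅_⁆; ∣_∣; inside; outside)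
open import Data.Fin.Subset.Properties
  using (_∈?_; nonempty?; Empty-unique; ∉⊥; ⊥⊆; ∣⊥∣≡0; ∣⁅x⁆∣≡1; ∣p∣≤∣x∷p∣; ∣p∩q∣≤∣q∣; in⊆in; out⊆;
         p⊆p∪q; p─q⊆p; p⊆q⇒∣p∣≤∣q∣; p⊂q⇒∣p∣<∣q∣; x∈p⇒∣p-x∣<∣p∣; x∈⁅x⁆; x∈⁅y⁆⇒x≡y;
         x∈p∪q⁻; x∈p∪q⁺; x∈p∩q⁻; x∈p∧x∉q⇒x∈p─q)
open import Data.Nat as ℕ using (ℕ; zero; suc; _≤_; _<_; _+_; z≤n; s≤s; _≟_)
open import Data.Nat.Induction using (<-wellFounded)
open import Data.Nat.Properties
  using (≤-trans; ≤-reflexive; <⇒≤; n≤1+n; m≤m+n; m≤n+m; 1+n≰n; ≰⇒>; ≮⇒≥; ≤∧≢⇒<; +-suc; +-assoc;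
         +-identityʳ; +-mono-≤; +-monoˡ-≤; +-monoʳ-≤; *-monoʳ-≤; +-cancelʳ-≤; *-cancelˡ-≤;
         module ≤-Reasoning)
open import Data.Nat.Tactic.RingSolver using (solve-∀)
open import Data.Product using (Σ; ∃; ∃₂; _×_; _,_; proj₁; proj₂)
open import Data.Sum as Sum using (_⊎_; inj₁; inj₂; [_,_])
open import Data.Unit using (⊤; tt)
open import Data.Vec using (Vec; []; _∷_; _∷ʳ_; lookup; head; last; tabulate; here; there)
open import Data.Vec.Properties using ([]=⇒lookup; lookup⇒[]=; lookup∘tabulate; last-∷ʳ)
open import Data.Vec.Relation.Unary.All as All using (All; []; _∷_)
open import Data.Vec.Relation.Unary.All.Properties using (lookup⁺)
open import Data.Vec.Relation.Unary.AllPairs as AllPairs using ([]; _∷_)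
open import Data.Vec.Relation.Unary.Linked as Linked using (Linked; []; [-]; _∷_)
open import Data.Vec.Relation.Unary.Unique.Propositional using (Unique)
open import Data.Vec.Relation.Unary.Unique.Propositional.Properties using (lookup-injective)
open import Function using (_∘_)
open import Induction.WellFounded using (Acc; acc)
open import Level using (Level; 0ℓ)
open import Relation.Binary using (Rel; Decidable)
open import Relation.Binary.PropositionalEquality
  using (_≡_; _≢_; ≢-sym; refl; sym; trans; cong; cong₂; subst; subst₂)
open import Relation.Nullary using (Dec; yes; no; does; ¬_)
open import Relation.Nullary.Decidable using (dec-true; _×-dec_; ¬?)
open import Relation.Unary using (Pred)

private variable
  a r : Level
  A : Set a
  n m : ℕ

∣p∪q∣≤∣p∣+∣q∣ : (p q : Subset n) → ∣ p ∪ q ∣ ≤ ∣ p ∣ + ∣ q ∣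
∣p∪q∣≤∣p∣+∣q∣ []            []            = z≤n
∣p∪q∣≤∣p∣+∣q∣ (inside  ∷ p) (y ∷ q)       =
  s≤s (≤-trans (∣p∪q∣≤∣p∣+∣q∣ p q) (+-monoʳ-≤ ∣ p ∣ (∣p∣≤∣x∷p∣ y q)))
∣p∪q∣≤∣p∣+∣q∣ (outside ∷ p) (inside  ∷ q) =
  ≤-trans (s≤s (∣p∪q∣≤∣p∣+∣q∣ p q)) (≤-reflexive (sym (+-suc ∣ p ∣ ∣ q ∣)))
∣p∪q∣≤∣p∣+∣q∣ (outside ∷ p) (outside ∷ q) = ∣p∪q∣≤∣p∣+∣q∣ p q

∣p∣≤∣p─q∣+∣q∣ : (p q : Subset n) → ∣ p ∣ ≤ ∣ p ─ q ∣ + ∣ q ∣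
∣p∣≤∣p─q∣+∣q∣ p q = ≤-trans (p⊆q⇒∣p∣≤∣q∣ p⊆p─q∪q) (∣p∪q∣≤∣p∣+∣q∣ (p ─ q) q)
  where
  p⊆p─q∪q : p ⊆ (p ─ q) ∪ q
  p⊆p─q∪q {x} x∈p with x ∈? q
  ... | yes x∈q = x∈p∪q⁺ (inj₂ x∈q)
  ... | no  x∉q = x∈p∪q⁺ (inj₁ (x∈p∧x∉q⇒x∈p─q x∈p x∉q))

x∈p─q⇒x∉q : {x : Fin n} (p q : Subset n) → x ∈ p ─ q → x ∉ q
x∈p─q⇒x∉q (_ ∷ p)      (outside ∷ q) (there x∈p─q) (there x∈q) = x∈p─q⇒x∉q p q x∈p─q x∈q
x∈p─q⇒x∉q (_ ∷ p)      (inside ∷ q)  (there x∈p─q) (there x∈q) = x∈p─q⇒x∉q p q x∈p─q x∈q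
x∈p─q⇒x∉q (inside ∷ p) (outside ∷ q) here          ()

x∈p∩q─r⁻ : {x : Fin n} (p q r : Subset n) → x ∈ (p ∩ q) ─ r → x ∈ p × x ∈ q ─ r
x∈p∩q─r⁻ p q r x∈ =
  let x∈p , x∈q = x∈p∩q⁻ p q (p─q⊆p (p ∩ q) r x∈)
  in  x∈p , x∈p∧x∉q⇒x∈p─q x∈q (x∈p─q⇒x∉q (p ∩ q) r x∈)

x∈p∧y∉p⇒x≢y : {x y : Fin n} {p : Subset n} → x ∈ p → y ∉ p → x ≢ y
x∈p∧y∉p⇒x≢y {p = p} x∈p y∉p x≡y = y∉p (subst (_∈ p) x≡y x∈p)

subsetOfSize : ∀ t (p : Subset n) → t ≤ ∣ p ∣ → Σ (Subset n) λ q → q ⊆ p × ∣ q ∣ ≡ t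
subsetOfSize {n} zero p _ = ⊥ , ⊥⊆ , ∣⊥∣≡0 n
subsetOfSize (suc t) (inside ∷ p) (s≤s t≤∣p∣) with subsetOfSize t p t≤∣p∣
... | q , q⊆p , ∣q∣≡t = inside ∷ q , in⊆in q⊆p , cong suc ∣q∣≡t
subsetOfSize (suc t) (outside ∷ p) t<∣p∣ with subsetOfSize (suc t) p t<∣p∣
... | q , q⊆p , ∣q∣≡t = outside ∷ q , out⊆ q⊆p , ∣q∣≡t

∈-tabulate⁺ : {f : Fin n → Bool} {x : Fin n} → f x ≡ true → x ∈ tabulate f
∈-tabulate⁺ {f = f} {x} fx = lookup⇒[]= x (tabulate f) (trans (lookup∘tabulate f x) fx)

∈-tabulate⁻ : {f : Fin n → Bool} {x : Fin n} → x ∈ tabulate f → f x ≡ true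
∈-tabulate⁻ {f = f} {x} x∈ = trans (sym (lookup∘tabulate f x)) ([]=⇒lookup x∈)

module _ {P : Pred (Fin n) r} (P? : ∀ x → Dec (P x)) where

  filter : Subset n
  filter = tabulate (does ∘ P?)

  ∈-filter⁺ : {x : Fin n} → P x → x ∈ filter
  ∈-filter⁺ {x} px = ∈-tabulate⁺ (dec-true (P? x) px)

  ∈-filter⁻ : {x : Fin n} → x ∈ filter → P x
  ∈-filter⁻ {x} x∈ with P? x | ∈-tabulate⁻ {f = does ∘ P?} x∈
  ... | yes px | _ = px

lookup-∷ʳ-fromℕ : (xs : Vec A m) (x : A) → lookup (xs ∷ʳ x) (fromℕ m) ≡ x
lookup-∷ʳ-fromℕ []       x = refl
lookup-∷ʳ-fromℕ (_ ∷ xs) x = lookup-∷ʳ-fromℕ xs x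

All-∷ʳ : {P : Pred A r} {xs : Vec A m} {x : A} → All P xs → P x → All P (xs ∷ʳ x)
All-∷ʳ []         px = px ∷ []
All-∷ʳ (py ∷ pxs) px = py ∷ All-∷ʳ pxs px

All-last : {P : Pred A r} {xs : Vec A (suc m)} → All P xs → P (last xs)
All-last {xs = _ ∷ []}    (px ∷ []) = px
All-last {xs = _ ∷ _ ∷ _} (_ ∷ pxs) = All-last pxs

Linked-∷ʳ : {R : Rel A r} {xs : Vec A (suc m)} {x : A} → Linked R xs → R (last xs) x → Linked R (xs ∷ʳ x)
Linked-∷ʳ {xs = _ ∷ []}    [-]       r = r ∷ [-]
Linked-∷ʳ {xs = _ ∷ _ ∷ _} (r′ ∷ rs) r = r′ ∷ Linked-∷ʳ rs r

Unique-∷ʳ : {xs : Vec A m} {x : A} → Unique xs → All (_≢ x) xs → Unique (xs ∷ʳ x)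
Unique-∷ʳ []           []           = [] ∷ []
Unique-∷ʳ (y∉ys ∷ uys) (y≢x ∷ ys≢x) = All-∷ʳ y∉ys y≢x ∷ Unique-∷ʳ uys ys≢x

record Path (_~_ : Rel (Fin n) 0ℓ) (Z : Subset n) (len : ℕ) : Set where
  field
    vertices : Vec (Fin n) len
    unique   : Unique vertices
    within   : All (_∈ Z) vertices
    linked   : Linked _~_ vertices

PathBetween : Rel (Fin n) 0ℓ → Subset n → ℕ → Subset n → Subset n → Set
PathBetween _~_ Z m S T =
  Σ (Path _~_ Z (suc m)) λ P → head (Path.vertices P) ∈ S × last (Path.vertices P) ∈ T

Joined : Rel (Fin n) 0ℓ → ℕ → Set
Joined {n} _~_ t = ∀ (A B : Subset n) → (∀ x → x ∈ A → x ∉ B) → t ≤ ∣ A ∣ → t ≤ ∣ B ∣ →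
  ∃₂ λ a b → a ∈ A × b ∈ B × a ~ b

module _ {_~_ : Rel (Fin n) 0ℓ} {t : ℕ} (joined : Joined _~_ t) {A B : Subset n}
         (disjoint : ∀ x → x ∈ A → x ∉ B) (no-edge : ∀ {a b} → a ∈ A → b ∈ B → ¬ a ~ b) where

  no-edge⇒∣B∣<t : t ≤ ∣ A ∣ → ∣ B ∣ < t
  no-edge⇒∣B∣<t t≤∣A∣ = ≰⇒> λ t≤∣B∣ →
    let _ , _ , a∈A , b∈B , a~b = joined A B disjoint t≤∣A∣ t≤∣B∣ in no-edge a∈A b∈B a~b

  no-edge⇒∣A∣<t : t ≤ ∣ B ∣ → ∣ A ∣ < t
  no-edge⇒∣A∣<t t≤∣B∣ = ≰⇒> λ t≤∣A∣ →
    let _ , _ , a∈A , b∈B , a~b = joined A B disjoint t≤∣A∣ t≤∣B∣ in no-edge a∈A b∈B a~b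

-- Depth-first search in a joined relation (Ben-Eliezer, Krivelevich and Sudakov)

module DepthFirstSearch {_~_ : Rel (Fin n) 0ℓ} (_~?_ : Decidable _~_) {t : ℕ} (joined : Joined _~_ t)
  (1≤t : 1 ≤ t) (ℓ : ℕ) (Z : Subset n) (Z-large : t + t + ℓ ≤ suc ∣ Z ∣) where

  -- The stack is the current path, its most recently visited vertex first.
  record State {len : ℕ} (stack : Vec (Fin n) len) : Set where
    field
      finished unvisited : Subset n
      stack⊆Z            : All (_∈ Z) stack
      stack-unique       : Unique stack
      stack-linked       : Linked _~_ stack
      stack∉unvisited    : All (_∉ unvisited) stack
      stack∉finished     : All (_∉ finished) stack
      unvisited⊆Z        : unvisited ⊆ Z
      unvisited∉finished : ∀ x → x ∈ unvisited → x ∉ finished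
      no-edge            : ∀ {u s} → u ∈ unvisited → s ∈ finished → ¬ u ~ s
      covering           : ∣ Z ∣ ≤ ∣ finished ∣ + ∣ unvisited ∣ + len
      finished-small     : ∣ finished ∣ < t
      len≤ℓ              : len ≤ ℓ
  open State

  measure : ∀ {len} {stack : Vec (Fin n) len} → State stack → ℕ
  measure {len} st = 2 ℕ.* ∣ unvisited st ∣ + len

  Next : ∀ {len} {stack : Vec (Fin n) len} → State stack → Set
  Next st = Σ ℕ λ len′ → Σ (Vec (Fin n) len′) λ stack′ → Σ (State stack′) λ st′ → measure st′ < measure st

  -- Otherwise Z, covered by the finished, unvisited and stacked vertices, would have at most
  -- (t − 1) + (t − 1) + ℓ elements.
  t≤∣unvisited∣ : ∀ {len} {stack : Vec (Fin n) len} (st : State stack) → t ≤ ∣ unvisited st ∣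
  t≤∣unvisited∣ {len} st = ≮⇒≥ λ ∣U∣<t → 1+n≰n (begin
    suc (suc ∣ Z ∣)                ≤⟨ s≤s (s≤s (covering st)) ⟩
    suc (suc (∣ S ∣ + ∣ U ∣ + len))  ≡⟨ cong (λ k → suc (k + len)) (sym (+-suc ∣ S ∣ ∣ U ∣)) ⟩
    suc ∣ S ∣ + suc ∣ U ∣ + len      ≤⟨ +-mono-≤ (+-mono-≤ (finished-small st) ∣U∣<t) (len≤ℓ st) ⟩
    t + t + ℓ                      ≤⟨ Z-large ⟩
    suc ∣ Z ∣                      ∎)
    where
    open ≤-Reasoning
    S U : Subset n
    S = finished st
    U = unvisited st

  push : ∀ {len} {stack : Vec (Fin n) len} (st : State stack) {x : Fin n} → len < ℓ →
         x ∈ unvisited st → Linked _~_ (x ∷ stack) → Next st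
  push {len} {stack} st {x} len<ℓ x∈U linked = suc len , x ∷ stack , st′ , decrease
    where
    S U U⁻ : Subset n
    S  = finished st
    U  = unvisited st
    U⁻ = U - x

    U⁻⊆U : U⁻ ⊆ U
    U⁻⊆U = p─q⊆p U ⁅ x ⁆

    x∉U⁻ : x ∉ U⁻
    x∉U⁻ x∈U⁻ = x∈p─q⇒x∉q U ⁅ x ⁆ x∈U⁻ (x∈⁅x⁆ x)

    shift : ∀ a b c → a + (b + 1) + c ≡ a + b + suc c
    shift = solve-∀

    covering⁺ : ∣ Z ∣ ≤ ∣ S ∣ + ∣ U⁻ ∣ + suc len
    covering⁺ = begin
      ∣ Z ∣                          ≤⟨ covering st ⟩
      ∣ S ∣ + ∣ U ∣ + len              ≤⟨ +-monoˡ-≤ len (+-monoʳ-≤ ∣ S ∣ (∣p∣≤∣p─q∣+∣q∣ U ⁅ x ⁆)) ⟩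
      ∣ S ∣ + (∣ U⁻ ∣ + ∣ ⁅ x ⁆ ∣) + len ≡⟨ cong (λ k → ∣ S ∣ + (∣ U⁻ ∣ + k) + len) (∣⁅x⁆∣≡1 x) ⟩
      ∣ S ∣ + (∣ U⁻ ∣ + 1) + len       ≡⟨ shift ∣ S ∣ ∣ U⁻ ∣ len ⟩
      ∣ S ∣ + ∣ U⁻ ∣ + suc len         ∎
      where open ≤-Reasoning

    st′ : State (x ∷ stack)
    st′ = record
      { finished           = S
      ; unvisited          = U⁻
      ; stack⊆Z            = unvisited⊆Z st x∈U ∷ stack⊆Z st
      ; stack-unique       = All.map (x∈p∧y∉p⇒x≢y x∈U) (stack∉unvisited st) ∷ stack-unique st
      ; stack-linked       = linked
      ; stack∉unvisited    = x∉U⁻ ∷ All.map (_∘ U⁻⊆U) (stack∉unvisited st)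
      ; stack∉finished     = unvisited∉finished st x x∈U ∷ stack∉finished st
      ; unvisited⊆Z        = unvisited⊆Z st ∘ U⁻⊆U
      ; unvisited∉finished = λ y → unvisited∉finished st y ∘ U⁻⊆U
      ; no-edge            = no-edge st ∘ U⁻⊆U
      ; covering           = covering⁺
      ; finished-small     = finished-small st
      ; len≤ℓ              = len<ℓ
      }

    regroup : ∀ a c → suc (2 ℕ.* a + suc c) ≡ 2 ℕ.* suc a + c
    regroup = solve-∀

    decrease : 2 ℕ.* ∣ U⁻ ∣ + suc len < 2 ℕ.* ∣ U ∣ + len
    decrease = ≤-trans (≤-reflexive (regroup ∣ U⁻ ∣ len)) (+-monoˡ-≤ len (*-monoʳ-≤ 2 (x∈p⇒∣p-x∣<∣p∣ x∈U)))

  pop : ∀ {len} {y : Fin n} {stack : Vec (Fin n) len} (st : State (y ∷ stack)) →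
        (∀ {u} → u ∈ unvisited st → ¬ u ~ y) → Next st
  pop {len} {y} {stack} st y-isolated = len , stack , st′ , ≤-reflexive (sym (+-suc _ len))
    where
    S U S⁺ : Subset n
    S  = finished st
    U  = unvisited st
    S⁺ = S ∪ ⁅ y ⁆

    ∈S⁺ : ∀ {s} → s ∈ S⁺ → s ∈ S ⊎ s ≡ y
    ∈S⁺ s∈S⁺ = Sum.map₂ (x∈⁅y⁆⇒x≡y y) (x∈p∪q⁻ S ⁅ y ⁆ s∈S⁺)

    U∉S⁺ : ∀ x → x ∈ U → x ∉ S⁺
    U∉S⁺ x x∈U x∈S⁺ with ∈S⁺ x∈S⁺
    ... | inj₁ x∈S  = unvisited∉finished st x x∈U x∈S
    ... | inj₂ refl = All.head (stack∉unvisited st) x∈U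

    no-edge⁺ : ∀ {u s} → u ∈ U → s ∈ S⁺ → ¬ u ~ s
    no-edge⁺ u∈U s∈S⁺ with ∈S⁺ s∈S⁺
    ... | inj₁ s∈S  = no-edge st u∈U s∈S
    ... | inj₂ refl = y-isolated u∈U

    ∣S∣<∣S⁺∣ : ∣ S ∣ < ∣ S⁺ ∣
    ∣S∣<∣S⁺∣ = p⊂q⇒∣p∣<∣q∣ (p⊆p∪q ⁅ y ⁆ , y , x∈p∪q⁺ (inj₂ (x∈⁅x⁆ y)) , All.head (stack∉finished st))

    stack∉S⁺ : All (_∉ S⁺) stack
    stack∉S⁺ = All.map (λ (z∉S , y≢z) z∈S⁺ → [ z∉S , ≢-sym y≢z ] (∈S⁺ z∈S⁺))
                       (All.zip (All.tail (stack∉finished st) , AllPairs.head (stack-unique st)))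

    st′ : State stack
    st′ = record
      { finished           = S⁺
      ; unvisited          = U
      ; stack⊆Z            = All.tail (stack⊆Z st)
      ; stack-unique       = AllPairs.tail (stack-unique st)
      ; stack-linked       = Linked.tail (stack-linked st)
      ; stack∉unvisited    = All.tail (stack∉unvisited st)
      ; stack∉finished     = stack∉S⁺
      ; unvisited⊆Z        = unvisited⊆Z st
      ; unvisited∉finished = U∉S⁺
      ; no-edge            = no-edge⁺
      ; covering           = ≤-trans (covering st)
          (≤-trans (≤-reflexive (+-suc (∣ S ∣ + ∣ U ∣) len)) (+-monoˡ-≤ len (+-monoˡ-≤ ∣ U ∣ ∣S∣<∣S⁺∣)))
      ; finished-small     = no-edge⇒∣B∣<t joined U∉S⁺ no-edge⁺ (t≤∣unvisited∣ st)
      ; len≤ℓ              = ≤-trans (n≤1+n len) (len≤ℓ st)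
      }

  step : ∀ {len} {stack : Vec (Fin n) len} (st : State stack) → len < ℓ → Next st
  step {stack = []} st len<ℓ with nonempty? (unvisited st)
  ... | yes (x , x∈U) = push st len<ℓ x∈U [-]
  ... | no  U-empty   = ⊥-elim (1+n≰n (begin
    1                 ≤⟨ 1≤t ⟩
    t                 ≤⟨ t≤∣unvisited∣ st ⟩
    ∣ unvisited st ∣  ≡⟨ cong ∣_∣ (Empty-unique U-empty) ⟩
    ∣ ⊥ {n = n} ∣      ≡⟨ ∣⊥∣≡0 n ⟩
    0                 ∎))
    where open ≤-Reasoning
  step {stack = y ∷ _} st len<ℓ with any? (λ u → u ∈? unvisited st ×-dec u ~? y)
  ... | yes (x , x∈U , x~y) = push st len<ℓ x∈U (x~y ∷ stack-linked st)
  ... | no  y-isolated      = pop st (λ u∈U u~y → y-isolated (_ , u∈U , u~y))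

  search : ∀ {len} {stack : Vec (Fin n) len} (st : State stack) → Acc _<_ (measure st) → Path _~_ Z ℓ
  search {len} {stack} st (acc smaller) with len ≟ ℓ
  ... | yes refl = record
    { vertices = stack ; unique = stack-unique st ; within = stack⊆Z st ; linked = stack-linked st }
  ... | no len≢ℓ with step st (≤∧≢⇒< (len≤ℓ st) len≢ℓ)
  ...   | _ , _ , st′ , decrease = search st′ (smaller decrease)

  initial : State []
  initial = record
    { finished           = ⊥
    ; unvisited          = Z
    ; stack⊆Z            = []
    ; stack-unique       = []
    ; stack-linked       = []
    ; stack∉unvisited    = []
    ; stack∉finished     = []
    ; unvisited⊆Z        = λ z∈Z → z∈Z
    ; unvisited∉finished = λ _ _ → ∉⊥
    ; no-edge            = λ _ s∈⊥ → ⊥-elim (∉⊥ s∈⊥)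
    ; covering           = ≤-reflexive (sym (trans (cong (λ k → k + ∣ Z ∣ + 0) (∣⊥∣≡0 n)) (+-identityʳ ∣ Z ∣)))
    ; finished-small     = subst (_< t) (sym (∣⊥∣≡0 n)) 1≤t
    ; len≤ℓ              = z≤n
    }

  longPath : Path _~_ Z ℓ
  longPath = search initial (<-wellFounded _)

private
  budget⇒2t+u≤ : ∀ u ℓ t → t + t + u ≤ u + ℓ + 6 ℕ.* t
  budget⇒2t+u≤ u ℓ t = subst (t + t + u ≤_) (split u ℓ t) (m≤m+n (t + t + u) (ℓ + 4 ℕ.* t))
    where
    split : ∀ u ℓ t → t + t + u + (ℓ + 4 ℕ.* t) ≡ u + ℓ + 6 ℕ.* t
    split = solve-∀

  budget⇒Z-large : ∀ {u ℓ t b z p q} → u + ℓ + 6 ℕ.* t ≤ 2 ℕ.* b → 2 ℕ.* b ≤ z + (p + q) + t + t + u →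
                   p ≤ t → q ≤ t → t + t + ℓ ≤ suc z
  budget⇒Z-large {u} {ℓ} {t} {b} {z} {p} {q} budget bound p≤t q≤t =
    +-cancelʳ-≤ (u + 4 ℕ.* t) (t + t + ℓ) (suc z) (begin
      t + t + ℓ + (u + 4 ℕ.* t)  ≡⟨ lhs t ℓ u ⟩
      u + ℓ + 6 ℕ.* t            ≤⟨ budget ⟩
      2 ℕ.* b                    ≤⟨ bound ⟩
      z + (p + q) + t + t + u    ≤⟨ +-monoˡ-≤ u (+-monoˡ-≤ t (+-monoˡ-≤ t (+-monoʳ-≤ z (+-mono-≤ p≤t q≤t)))) ⟩
      z + (t + t) + t + t + u    ≡⟨ rhs z t u ⟩
      z + (u + 4 ℕ.* t)          ≤⟨ n≤1+n _ ⟩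
      suc z + (u + 4 ℕ.* t)      ∎)
    where
    open ≤-Reasoning
    lhs : ∀ t ℓ u → t + t + ℓ + (u + 4 ℕ.* t) ≡ u + ℓ + 6 ℕ.* t
    lhs = solve-∀
    rhs : ∀ z t u → z + (t + t) + t + t + u ≡ z + (u + 4 ℕ.* t)
    rhs = solve-∀

module Connecting {_~_ : Rel (Fin n) 0ℓ} (_~?_ : Decidable _~_) {t : ℕ} (joined : Joined _~_ t)
  (1≤t : 1 ≤ t) (ℓ : ℕ) (X U NA NB : Subset n) (b : ℕ) (budget : ∣ U ∣ + ℓ + 6 ℕ.* t ≤ 2 ℕ.* b)
  (NA-large : 2 ℕ.* b ≤ ∣ NA ∩ X ∣) (NB-large : 2 ℕ.* b ≤ ∣ NB ∩ X ∣) where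

  module _ (A B : Subset n) (A⊆ : A ⊆ (NA ∩ X) ─ U) (∣A∣≡t : ∣ A ∣ ≡ t)
           (B⊆ : B ⊆ ((NB ∩ X) ─ U) ─ A) (∣B∣≡t : ∣ B ∣ ≡ t) where

    Z₀ : Subset n
    Z₀ = ((X ─ U) ─ A) ─ B

    ∈A⁻ : ∀ {a} → a ∈ A → a ∈ NA × a ∈ X ─ U
    ∈A⁻ a∈A = x∈p∩q─r⁻ NA X U (A⊆ a∈A)

    ∈B⁻ : ∀ {x} → x ∈ B → x ∈ NB × x ∈ X ─ U × x ∉ A
    ∈B⁻ x∈B =
      let x∈NB , x∈X─U = x∈p∩q─r⁻ NB X U (p─q⊆p _ A (B⊆ x∈B))
      in  x∈NB , x∈X─U , x∈p─q⇒x∉q _ A (B⊆ x∈B)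

    ∈Z₀⁻ : ∀ {z} → z ∈ Z₀ → z ∈ X ─ U × z ∉ A × z ∉ B
    ∈Z₀⁻ z∈Z₀ =
      let z∈ = p─q⊆p _ B z∈Z₀ in p─q⊆p _ A z∈ , x∈p─q⇒x∉q _ A z∈ , x∈p─q⇒x∉q _ B z∈Z₀

    HasNeighbourInA HasNeighbourInB : Fin n → Set
    HasNeighbourInA z = ∃ λ a → a ∈ A × a ~ z
    HasNeighbourInB z = ∃ λ x → x ∈ B × z ~ x

    hasNeighbourInA? : ∀ z → Dec (HasNeighbourInA z)
    hasNeighbourInA? z = any? (λ a → a ∈? A ×-dec a ~? z)

    hasNeighbourInB? : ∀ z → Dec (HasNeighbourInB z)
    hasNeighbourInB? z = any? (λ x → x ∈? B ×-dec z ~? x)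

    good? : ∀ z → Dec (z ∈ Z₀ × HasNeighbourInA z × HasNeighbourInB z)
    good? z = z ∈? Z₀ ×-dec hasNeighbourInA? z ×-dec hasNeighbourInB? z

    badA? : ∀ z → Dec (z ∈ Z₀ × ¬ HasNeighbourInA z)
    badA? z = z ∈? Z₀ ×-dec ¬? (hasNeighbourInA? z)

    badB? : ∀ z → Dec (z ∈ Z₀ × ¬ HasNeighbourInB z)
    badB? z = z ∈? Z₀ ×-dec ¬? (hasNeighbourInB? z)

    Z BadA BadB : Subset n
    Z    = filter good?
    BadA = filter badA?
    BadB = filter badB?

    t≤∣A∣ : t ≤ ∣ A ∣
    t≤∣A∣ = ≤-reflexive (sym ∣A∣≡t)

    t≤∣B∣ : t ≤ ∣ B ∣
    t≤∣B∣ = ≤-reflexive (sym ∣B∣≡t)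

    ∣BadA∣<t : ∣ BadA ∣ < t
    ∣BadA∣<t = no-edge⇒∣B∣<t joined
      (λ a a∈A a∈BadA → proj₁ (proj₂ (∈Z₀⁻ (proj₁ (∈-filter⁻ badA? a∈BadA)))) a∈A)
      (λ a∈A z∈BadA a~z → proj₂ (∈-filter⁻ badA? z∈BadA) (_ , a∈A , a~z))
      t≤∣A∣

    ∣BadB∣<t : ∣ BadB ∣ < t
    ∣BadB∣<t = no-edge⇒∣A∣<t joined
      (λ z z∈BadB z∈B → proj₂ (proj₂ (∈Z₀⁻ (proj₁ (∈-filter⁻ badB? z∈BadB)))) z∈B)
      (λ z∈BadB x∈B z~x → proj₂ (∈-filter⁻ badB? z∈BadB) (_ , x∈B , z~x))
      t≤∣B∣

    Z₀⊆Z∪Bad : Z₀ ⊆ Z ∪ (BadA ∪ BadB)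
    Z₀⊆Z∪Bad {z} z∈Z₀ with hasNeighbourInA? z | hasNeighbourInB? z
    ... | yes inA | yes inB = x∈p∪q⁺ (inj₁ (∈-filter⁺ good? (z∈Z₀ , inA , inB)))
    ... | no ¬inA | _       = x∈p∪q⁺ (inj₂ (x∈p∪q⁺ (inj₁ (∈-filter⁺ badA? (z∈Z₀ , ¬inA)))))
    ... | yes _   | no ¬inB = x∈p∪q⁺ (inj₂ (x∈p∪q⁺ (inj₂ (∈-filter⁺ badB? (z∈Z₀ , ¬inB)))))

    ∣Z₀∣≤ : ∣ Z₀ ∣ ≤ ∣ Z ∣ + (∣ BadA ∣ + ∣ BadB ∣)
    ∣Z₀∣≤ = ≤-trans (p⊆q⇒∣p∣≤∣q∣ Z₀⊆Z∪Bad)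
      (≤-trans (∣p∪q∣≤∣p∣+∣q∣ Z (BadA ∪ BadB)) (+-monoʳ-≤ ∣ Z ∣ (∣p∪q∣≤∣p∣+∣q∣ BadA BadB)))

    Z-large : t + t + ℓ ≤ suc ∣ Z ∣
    Z-large = budget⇒Z-large {b = b} {∣ Z ∣} {∣ BadA ∣} {∣ BadB ∣} budget (begin
      2 ℕ.* b                                           ≤⟨ NA-large ⟩
      ∣ NA ∩ X ∣                                         ≤⟨ ∣p∩q∣≤∣q∣ NA X ⟩
      ∣ X ∣                                              ≤⟨ ∣p∣≤∣p─q∣+∣q∣ X U ⟩
      ∣ X ─ U ∣ + ∣ U ∣                                   ≤⟨ +-monoˡ-≤ ∣ U ∣ (∣p∣≤∣p─q∣+∣q∣ (X ─ U) A) ⟩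
      ∣ (X ─ U) ─ A ∣ + ∣ A ∣ + ∣ U ∣                      ≤⟨ +-monoˡ-≤ ∣ U ∣ (+-monoˡ-≤ ∣ A ∣
                                                           (∣p∣≤∣p─q∣+∣q∣ ((X ─ U) ─ A) B)) ⟩
      ∣ Z₀ ∣ + ∣ B ∣ + ∣ A ∣ + ∣ U ∣                       ≤⟨ +-monoˡ-≤ ∣ U ∣ (+-monoˡ-≤ ∣ A ∣ (+-monoˡ-≤ ∣ B ∣ ∣Z₀∣≤)) ⟩
      ∣ Z ∣ + (∣ BadA ∣ + ∣ BadB ∣) + ∣ B ∣ + ∣ A ∣ + ∣ U ∣ ≡⟨ cong₂ (λ x y → ∣ Z ∣ + (∣ BadA ∣ + ∣ BadB ∣) + x + y + ∣ U ∣)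
                                                           ∣B∣≡t ∣A∣≡t ⟩
      ∣ Z ∣ + (∣ BadA ∣ + ∣ BadB ∣) + t + t + ∣ U ∣         ∎)
      (<⇒≤ ∣BadA∣<t) (<⇒≤ ∣BadB∣<t)
      where open ≤-Reasoning

    extend : ∀ {m} → Path _~_ Z m → PathBetween _~_ (X ─ U) (suc m) NA NB
    extend record { vertices = [] } =
      let a , x , a∈A , x∈B , a~x = joined A B (λ a a∈A a∈B → proj₂ (proj₂ (∈B⁻ a∈B)) a∈A) t≤∣A∣ t≤∣B∣
      in record
           { vertices = a ∷ x ∷ []
           ; unique   = (x∈p∧y∉p⇒x≢y a∈A (proj₂ (proj₂ (∈B⁻ x∈B))) ∷ []) ∷ [] ∷ []
           ; within   = proj₂ (∈A⁻ a∈A) ∷ proj₁ (proj₂ (∈B⁻ x∈B)) ∷ []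
           ; linked   = a~x ∷ [-]
           } , proj₁ (∈A⁻ a∈A) , proj₁ (∈B⁻ x∈B)
    extend record { vertices = y ∷ ys ; unique = unique ; within = within ; linked = linked } =
      let a , a∈A , a~y = proj₁ (proj₂ (∈-filter⁻ good? (All.head within)))
          x , x∈B , z~x = proj₂ (proj₂ (∈-filter⁻ good? (All-last within)))
          x∈NB , x∈X─U , x∉A = ∈B⁻ x∈B
          in-Z₀ = All.map (proj₁ ∘ ∈-filter⁻ good?) within
      in record
           { vertices = a ∷ ((y ∷ ys) ∷ʳ x)
           ; unique   = All-∷ʳ (All.map (x∈p∧y∉p⇒x≢y a∈A ∘ proj₁ ∘ proj₂ ∘ ∈Z₀⁻) in-Z₀) (x∈p∧y∉p⇒x≢y a∈A x∉A)
                      ∷ Unique-∷ʳ unique (All.map (λ z∈Z₀ → ≢-sym (x∈p∧y∉p⇒x≢y x∈B (proj₂ (proj₂ (∈Z₀⁻ z∈Z₀)))))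
                                                  in-Z₀)
           ; within   = proj₂ (∈A⁻ a∈A) ∷ All-∷ʳ (All.map (proj₁ ∘ ∈Z₀⁻) in-Z₀) x∈X─U
           ; linked   = a~y ∷ Linked-∷ʳ linked z~x
           } , proj₁ (∈A⁻ a∈A) , subst (_∈ NB) (sym (last-∷ʳ x (a ∷ y ∷ ys))) x∈NB

    bridge : PathBetween _~_ (X ─ U) (suc ℓ) NA NB
    bridge = extend (DepthFirstSearch.longPath _~?_ joined 1≤t ℓ Z Z-large)

  A-large : t ≤ ∣ (NA ∩ X) ─ U ∣
  A-large = +-cancelʳ-≤ (∣ U ∣) t (∣ (NA ∩ X) ─ U ∣) (begin
    t + ∣ U ∣              ≤⟨ m≤n+m (t + ∣ U ∣) t ⟩
    t + (t + ∣ U ∣)        ≡⟨ sym (+-assoc t t ∣ U ∣) ⟩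
    t + t + ∣ U ∣          ≤⟨ budget⇒2t+u≤ ∣ U ∣ ℓ t ⟩
    ∣ U ∣ + ℓ + 6 ℕ.* t    ≤⟨ budget ⟩
    2 ℕ.* b                ≤⟨ NA-large ⟩
    ∣ NA ∩ X ∣              ≤⟨ ∣p∣≤∣p─q∣+∣q∣ (NA ∩ X) U ⟩
    ∣ (NA ∩ X) ─ U ∣ + ∣ U ∣ ∎)
    where open ≤-Reasoning

  B-large : (A : Subset n) → ∣ A ∣ ≡ t → t ≤ ∣ ((NB ∩ X) ─ U) ─ A ∣
  B-large A ∣A∣≡t = +-cancelʳ-≤ (t + ∣ U ∣) t (∣ B₀ ∣) (begin
    t + (t + ∣ U ∣)          ≡⟨ sym (+-assoc t t ∣ U ∣) ⟩
    t + t + ∣ U ∣            ≤⟨ budget⇒2t+u≤ ∣ U ∣ ℓ t ⟩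
    ∣ U ∣ + ℓ + 6 ℕ.* t      ≤⟨ budget ⟩
    2 ℕ.* b                  ≤⟨ NB-large ⟩
    ∣ NB ∩ X ∣                ≤⟨ ∣p∣≤∣p─q∣+∣q∣ (NB ∩ X) U ⟩
    ∣ (NB ∩ X) ─ U ∣ + ∣ U ∣   ≤⟨ +-monoˡ-≤ ∣ U ∣ (∣p∣≤∣p─q∣+∣q∣ ((NB ∩ X) ─ U) A) ⟩
    ∣ B₀ ∣ + ∣ A ∣ + ∣ U ∣      ≡⟨ +-assoc (∣ B₀ ∣) (∣ A ∣) (∣ U ∣) ⟩
    ∣ B₀ ∣ + (∣ A ∣ + ∣ U ∣)    ≡⟨ cong (λ k → ∣ B₀ ∣ + (k + ∣ U ∣)) ∣A∣≡t ⟩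
    ∣ B₀ ∣ + (t + ∣ U ∣)        ∎)
    where
    open ≤-Reasoning
    B₀ : Subset n
    B₀ = ((NB ∩ X) ─ U) ─ A

  connectingPath : PathBetween _~_ (X ─ U) (suc ℓ) NA NB
  connectingPath =
    let A , A⊆ , ∣A∣≡t = subsetOfSize t ((NA ∩ X) ─ U) A-large
        B , B⊆ , ∣B∣≡t = subsetOfSize t (((NB ∩ X) ─ U) ─ A) (B-large A ∣A∣≡t)
    in  bridge A B A⊆ ∣A∣≡t B⊆ ∣B∣≡t

module _ (D : Digraph n) where

  DoubleEdge : Fin n → Fin n → Set
  DoubleEdge x y = adj D x y ≡ true × adj D y x ≡ true

  doubleEdge? : Decidable DoubleEdge
  doubleEdge? x y = (adj D x y Bool.≟ true) ×-dec (adj D y x Bool.≟ true)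

  DoubleEdge⇒EdgeOK : ∀ s {x y} → DoubleEdge x y → EdgeOK D s x y
  DoubleEdge⇒EdgeOK true  (xy , _) = xy
  DoubleEdge⇒EdgeOK false (_ , yx) = yx

  ∈Nbr⇒EdgeOK : ∀ s {v a} → a ∈ Nbr D s v → EdgeOK D s v a
  ∈Nbr⇒EdgeOK true  = ∈-tabulate⁻
  ∈Nbr⇒EdgeOK false = ∈-tabulate⁻

  ∈Nbr-not⇒EdgeOK : ∀ s {v a} → a ∈ Nbr D (not s) v → EdgeOK D s a v
  ∈Nbr-not⇒EdgeOK true  = ∈-tabulate⁻
  ∈Nbr-not⇒EdgeOK false = ∈-tabulate⁻

  biPseudorandom⇒joined : ∀ {t} → BiPseudorandom D t → Joined DoubleEdge t
  biPseudorandom⇒joined {t} (_ , _ , pseudorandom) A B disjoint t≤∣A∣ t≤∣B∣ =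
    let A′ , A′⊆A , ∣A′∣≡t = subsetOfSize t A t≤∣A∣
        B′ , B′⊆B , ∣B′∣≡t = subsetOfSize t B t≤∣B∣
        a , b , a∈A′ , b∈B′ , ab =
          pseudorandom A′ B′ (λ x x∈A′ → disjoint x (A′⊆A x∈A′) ∘ B′⊆B) ∣A′∣≡t ∣B′∣≡t
    in  a , b , A′⊆A a∈A′ , B′⊆B b∈B′ , ab

  Oriented : ∀ {j} → Vec Bool j → Vec (Fin n) (suc j) → Set
  Oriented []      (_ ∷ [])    = ⊤
  Oriented (s ∷ σ) (x ∷ y ∷ w) = EdgeOK D s x y × Oriented σ (y ∷ w)

  oriented⇒follows : ∀ {j} (σ : Vec Bool j) (w : Vec (Fin n) (suc j)) →
                     Oriented σ w → Follows D (suc j) σ (lookup w)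
  oriented⇒follows (s ∷ σ) (x ∷ y ∷ w) (xy , _)  zero    = xy
  oriented⇒follows (s ∷ σ) (x ∷ y ∷ w) (_ , yw) (suc i) = oriented⇒follows σ (y ∷ w) yw i

  linked⇒oriented-∷ʳ : ∀ {j} (σ : Vec Bool (suc j)) {w : Vec (Fin n) (suc j)} {x : Fin n} →
    Linked DoubleEdge w → EdgeOK D (lookup σ (fromℕ j)) (last w) x → Oriented σ (w ∷ʳ x)
  linked⇒oriented-∷ʳ (s ∷ [])        [-]                    wx = wx , tt
  linked⇒oriented-∷ʳ (s ∷ σ@(_ ∷ _)) {_ ∷ _ ∷ _} (yz ∷ yw) wx = DoubleEdge⇒EdgeOK s yz , linked⇒oriented-∷ʳ σ yw wx

  copyAlongDoublePath : ∀ {j} (σ : Vec Bool (2 + j)) {Y : Subset n} {v v′ : Fin n} →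
    v ≢ v′ → v ∉ Y → v′ ∉ Y →
    PathBetween DoubleEdge Y j (Nbr D (lookup σ zero) v) (Nbr D (not (lookup σ (fromℕ (suc j)))) v′) →
    CopyIn D (3 + j) σ v v′ (Y ∪ (⁅ v ⁆ ∪ ⁅ v′ ⁆))
  copyAlongDoublePath {j} (s ∷ σ) {Y} {v} {v′} v≢v′ v∉Y v′∉Y
    (record { vertices = y ∷ ys ; unique = unique ; within = within ; linked = linked } , vy , yv′) =
    lookup w , (λ {i} {k} → lookup-injective w-unique i k) ,
    oriented⇒follows (s ∷ σ) w
      (∈Nbr⇒EdgeOK s vy , linked⇒oriented-∷ʳ σ linked (∈Nbr-not⇒EdgeOK (lookup σ (fromℕ j)) yv′)) ,
    refl , lookup-∷ʳ-fromℕ (v ∷ y ∷ ys) v′ , lookup⁺ w-within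
    where
    w : Vec (Fin n) (3 + j)
    w = v ∷ ((y ∷ ys) ∷ʳ v′)

    w-unique : Unique w
    w-unique = All-∷ʳ (All.map (λ z∈Y → ≢-sym (x∈p∧y∉p⇒x≢y z∈Y v∉Y)) within) v≢v′
             ∷ Unique-∷ʳ unique (All.map (λ z∈Y → x∈p∧y∉p⇒x≢y z∈Y v′∉Y) within)

    w-within : All (_∈ Y ∪ (⁅ v ⁆ ∪ ⁅ v′ ⁆)) w
    w-within = x∈p∪q⁺ (inj₂ (x∈p∪q⁺ (inj₁ (x∈⁅x⁆ v))))
             ∷ All-∷ʳ (All.map (x∈p∪q⁺ ∘ inj₁) within) (x∈p∪q⁺ (inj₂ (x∈p∪q⁺ (inj₂ (x∈⁅x⁆ v′)))))

open import Algebra.Bundles using (CommutativeRing)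
open import Data.Integer as ℤ using (+_)
import Data.Integer.Properties as ℤ
open import Data.Nat.Divisibility using (∣1⇒≡1)
open import Data.Rational using (ℚ; mkℚ; 1ℚ; Positive; _/_; _*_) renaming (_≤_ to _≤ℚ_)
import Data.Rational.Properties as ℚ
open import Algebra.Properties.CommutativeSemigroup
  (CommutativeRing.*-commutativeSemigroup ℚ.+-*-commutativeRing) using (xy∙z≈xz∙y)

ℕ→ℚ≡mkℚ : ∀ k → ℕ→ℚ k ≡ mkℚ (+ k) 0 (λ (_ , d∣1) → ∣1⇒≡1 d∣1)
ℕ→ℚ≡mkℚ k = ℚ.normalize-coprime _

ℕ→ℚ-* : ∀ a c → ℕ→ℚ a * ℕ→ℚ c ≡ ℕ→ℚ (a ℕ.* c)
ℕ→ℚ-* a c rewrite ℕ→ℚ≡mkℚ a | ℕ→ℚ≡mkℚ c = cong (_/ 1) (sym (ℤ.pos-* a c))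

ℕ→ℚ-cancel-≤ : ∀ {a c} → ℕ→ℚ a ≤ℚ ℕ→ℚ c → a ≤ c
ℕ→ℚ-cancel-≤ {a} {c} a≤c rewrite ℕ→ℚ≡mkℚ a | ℕ→ℚ≡mkℚ c =
  ℤ.drop‿+≤+ (subst₂ ℤ._≤_ (ℤ.*-identityʳ (+ a)) (ℤ.*-identityʳ (+ c)) (ℚ.drop-*≤* a≤c))

2εn≤βm/6⇒12t≤b : ∀ (ε β : ℚ) n m t b → ε * ℕ→ℚ n ≡ ℕ→ℚ t → β * ℕ→ℚ m ≡ ℕ→ℚ b →
  ℕ→ℚ 2 * ε * ℕ→ℚ n ≤ℚ β * ℕ→ℚ m * (+ 1 / 6) → 12 ℕ.* t ≤ b
2εn≤βm/6⇒12t≤b ε β n m t b εn≡t βm≡b 2εn≤βm/6 =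
  subst (_≤ b) (twelve t) (ℕ→ℚ-cancel-≤ (begin
    ℕ→ℚ (2 ℕ.* t ℕ.* 6)            ≡⟨ sym (ℕ→ℚ-* (2 ℕ.* t) 6) ⟩
    ℕ→ℚ (2 ℕ.* t) * ℕ→ℚ 6          ≡⟨ cong (_* ℕ→ℚ 6) (sym (ℕ→ℚ-* 2 t)) ⟩
    ℕ→ℚ 2 * ℕ→ℚ t * ℕ→ℚ 6          ≡⟨ cong (λ q → ℕ→ℚ 2 * q * ℕ→ℚ 6) (sym εn≡t) ⟩
    ℕ→ℚ 2 * (ε * ℕ→ℚ n) * ℕ→ℚ 6    ≡⟨ cong (_* ℕ→ℚ 6) (sym (ℚ.*-assoc (ℕ→ℚ 2) ε (ℕ→ℚ n))) ⟩
    ℕ→ℚ 2 * ε * ℕ→ℚ n * ℕ→ℚ 6      ≤⟨ ℚ.*-monoʳ-≤-nonNeg (ℕ→ℚ 6) 2εn≤βm/6 ⟩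
    β * ℕ→ℚ m * (+ 1 / 6) * ℕ→ℚ 6  ≡⟨ ℚ.*-assoc (β * ℕ→ℚ m) (+ 1 / 6) (ℕ→ℚ 6) ⟩
    β * ℕ→ℚ m * 1ℚ                 ≡⟨ ℚ.*-identityʳ (β * ℕ→ℚ m) ⟩
    β * ℕ→ℚ m                      ≡⟨ βm≡b ⟩
    ℕ→ℚ b                          ∎))
  where
  open ℚ.≤-Reasoning
  twelve : ∀ t → 2 ℕ.* t ℕ.* 6 ≡ 12 ℕ.* t
  twelve = solve-∀

x≤3βm/2⇒2x≤3b : ∀ (β : ℚ) m b x → β * ℕ→ℚ m ≡ ℕ→ℚ b →
  ℕ→ℚ x ≤ℚ (+ 3 / 2) * β * ℕ→ℚ m → x ℕ.* 2 ≤ 3 ℕ.* b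
x≤3βm/2⇒2x≤3b β m b x βm≡b x≤3βm/2 = ℕ→ℚ-cancel-≤ (begin
  ℕ→ℚ (x ℕ.* 2)                  ≡⟨ sym (ℕ→ℚ-* x 2) ⟩
  ℕ→ℚ x * ℕ→ℚ 2                  ≤⟨ ℚ.*-monoʳ-≤-nonNeg (ℕ→ℚ 2) x≤3βm/2 ⟩
  (+ 3 / 2) * β * ℕ→ℚ m * ℕ→ℚ 2  ≡⟨ cong (_* ℕ→ℚ 2) (trans (ℚ.*-assoc (+ 3 / 2) β (ℕ→ℚ m))
                                                           (cong ((+ 3 / 2) *_) βm≡b)) ⟩
  (+ 3 / 2) * ℕ→ℚ b * ℕ→ℚ 2      ≡⟨ xy∙z≈xz∙y (+ 3 / 2) (ℕ→ℚ b) (ℕ→ℚ 2) ⟩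
  ℕ→ℚ 3 * ℕ→ℚ b                  ≡⟨ ℕ→ℚ-* 3 b ⟩
  ℕ→ℚ (3 ℕ.* b)                  ∎)
  where open ℚ.≤-Reasoning

α½n≡αn½ : ∀ (α N : ℚ) → α * (+ 1 / 2) * N ≡ α * N * (+ 1 / 2)
α½n≡αn½ α N = xy∙z≈xz∙y α (+ 1 / 2) N

reservoir-budget : ∀ u ℓ t b → 12 ℕ.* t ≤ b → (u + (4 + ℓ)) ℕ.* 2 ≤ 3 ℕ.* b → u + ℓ + 6 ℕ.* t ≤ 2 ℕ.* b
reservoir-budget u ℓ t b 12t≤b 2k≤3b = *-cancelˡ-≤ 2 (begin
  2 ℕ.* (u + ℓ + 6 ℕ.* t)         ≤⟨ m≤m+n _ 8 ⟩
  2 ℕ.* (u + ℓ + 6 ℕ.* t) + 8     ≡⟨ split u ℓ t ⟩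
  (u + (4 + ℓ)) ℕ.* 2 + 12 ℕ.* t  ≤⟨ +-mono-≤ 2k≤3b 12t≤b ⟩
  3 ℕ.* b + b                     ≡⟨ join b ⟩
  2 ℕ.* (2 ℕ.* b)                 ∎)
  where
  open ≤-Reasoning
  split : ∀ u ℓ t → 2 ℕ.* (u + ℓ + 6 ℕ.* t) + 8 ≡ (u + (4 + ℓ)) ℕ.* 2 + 12 ℕ.* t
  split = solve-∀
  join : ∀ b → 3 ℕ.* b + b ≡ 2 ℕ.* (2 ℕ.* b)
  join = solve-∀

lemma6p8 : (α β ε : ℚ) → Positive α → Positive β → Positive ε →
    (k m n : ℕ) →
    ℕ→ℚ 2 * ε * ℕ→ℚ n ≤ℚ β * ℕ→ℚ m * (+ 1 / 6) →
    4 ≤ k → ℕ→ℚ k ≤ℚ (+ 3 / 2) * β * ℕ→ℚ m →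
    (P : OPath k) (D : Digraph n) →
    EpsBiPseudorandom D ε →
    MinTotalDegreeAtLeast D (ℕ→ℚ 2 * α * ℕ→ℚ n) →
    (X : Subset n) → Reservoir D α β m X →
    (v v' : Fin n) → v ≢ v' → v ∉ X → v' ∉ X →
    Compatible D (α * (+ 1 / 2)) k P v v' →
    (U : Subset n) → U ⊆ X →
    ℕ→ℚ (∣ U ∣ + k) ≤ℚ (+ 3 / 2) * β * ℕ→ℚ m →
    CopyIn D k P v v' ((X ─ U) ∪ (⁅ v ⁆ ∪ ⁅ v' ⁆))
lemma6p8 α β ε _ _ _ (suc (suc (suc (suc ℓ)))) m n 2εn≤βm/6 (s≤s (s≤s (s≤s (s≤s _)))) _ P D
  (t , εn≡t , bipseudorandom) _ X (b , βm≡b , _ , reservoir-degree , _)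
  v v′ v≢v′ v∉X v′∉X (v-degree , v′-degree) U _ u+k≤3βm/2 =
  copyAlongDoublePath D P v≢v′ (v∉X ∘ p─q⊆p X U) (v′∉X ∘ p─q⊆p X U) connectingPath
  where
  s₁ s₂ : Bool
  s₁ = lookup P zero
  s₂ = not (lookup P (fromℕ (2 + ℓ)))

  budget : ∣ U ∣ + ℓ + 6 ℕ.* t ≤ 2 ℕ.* b
  budget = reservoir-budget ∣ U ∣ ℓ t b (2εn≤βm/6⇒12t≤b ε β n m t b εn≡t βm≡b 2εn≤βm/6)
                                        (x≤3βm/2⇒2x≤3b β m b (∣ U ∣ + (4 + ℓ)) βm≡b u+k≤3βm/2)

  NA-large : 2 ℕ.* b ≤ ∣ Nbr D s₁ v ∩ X ∣
  NA-large = reservoir-degree v s₁ (subst (_≤ℚ ℕ→ℚ (deg D s₁ v)) (α½n≡αn½ α (ℕ→ℚ n)) v-degree)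

  NB-large : 2 ℕ.* b ≤ ∣ Nbr D s₂ v′ ∩ X ∣
  NB-large = reservoir-degree v′ s₂ (subst (_≤ℚ ℕ→ℚ (deg D s₂ v′)) (α½n≡αn½ α (ℕ→ℚ n)) v′-degree)

  open Connecting (doubleEdge? D) (biPseudorandom⇒joined D bipseudorandom) (proj₁ bipseudorandom)
    ℓ X U (Nbr D s₁ v) (Nbr D s₂ v′) b budget NA-large NB-large
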